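{- Let $\Gamma$ be a finite simple graph whose edges are each colored red, green or blue, with $R$ red, $G$ green and $B$ blue edges, and let $K$ be the number of properly $3$-edge-colored copies of $K_4$ in $\Gamma$. Then $K \le \frac14 \min\{RG,\ GB,\ RB\}$.
   Context: A properly $3$-edge-colored copy of $K_4$ is a set of four pairwise adjacent vertices such that, among its six edges, each color class is a perfect matching on the four vertices. -}

module Defs where

open import Data.Nat using (ℕ; zero; suc; _+_; _<ᵇ_)
open import Data.Nat.Base using (_≡ᵇ_)
open import Data.Bool using (Bool; true; false; _∧_; if_then_else_)
open import Data.Fin using (Fin; toℕ)
open import Data.List using (List; []; _∷_; length; filter; allFin; concatMap; map)
open import Data.Maybe using (Maybe; just; nothing)
open import Data.Product using (_×_; _,_)
open import Relation.Binary.PropositionalEquality using (_≡_)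
open import Relation.Nullary.Decidable using (Dec; yes; no)
open import Data.Bool.Properties using (_≟_)

data Colour : Set where
  red green blue : Colour

_==ᶜ_ : Colour → Colour → Bool
red   ==ᶜ red   = true
green ==ᶜ green = true
blue  ==ᶜ blue  = true
_     ==ᶜ _     = false

-- A finite simple graph on vertex set Fin n whose edges are coloured:
-- col i j = nothing  means i,j are not adjacent,
-- col i j = just k   means {i,j} is an edge of colour k.
record ColouredGraph (n : ℕ) : Set where
  field
    col   : Fin n → Fin n → Maybe Colour
    loopless : ∀ i → col i i ≡ nothing
    sym   : ∀ i j → col i j ≡ col j i
open ColouredGraph public

hasColour : ∀ {n} → ColouredGraph n → Colour → Fin n → Fin n → Bool
hasColour Γ k i j with col Γ i j
... | nothing = false
... | just k' = k' ==ᶜ k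

adjacent : ∀ {n} → ColouredGraph n → Fin n → Fin n → Bool
adjacent Γ i j with col Γ i j
... | nothing = false
... | just _  = true

_<ⱽ_ : ∀ {n} → Fin n → Fin n → Bool
i <ⱽ j = toℕ i <ᵇ toℕ j

pairs : (n : ℕ) → List (Fin n × Fin n)
pairs n = concatMap (λ i → map (λ j → (i , j)) (filter (λ j → Data.Bool.T? (i <ⱽ j)) (allFin n))) (allFin n)
  where import Data.Bool

-- All 4-element vertex sets {a, b, c, d}, listed once each as a < b < c < d.
Quad : ℕ → Set
Quad n = Fin n × Fin n × Fin n × Fin n

quads : (n : ℕ) → List (Quad n)
quads n =
  concatMap (λ { (a , b) →
    concatMap (λ { (c , d) → if (b <ⱽ c) then ((a , b , c , d) ∷ []) else [] })
              (pairs n) })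
    (pairs n)

numEdges : ∀ {n} → ColouredGraph n → Colour → ℕ
numEdges {n} Γ k = length (filter (λ { (i , j) → Data.Bool.T? (hasColour Γ k i j) }) (pairs n))
  where import Data.Bool

exactlyOne : Bool → Bool → Bool → Bool
exactlyOne true  false false = true
exactlyOne false true  false = true
exactlyOne false false true  = true
exactlyOne _     _     _     = false

colourClassPerfectMatching : ∀ {n} → ColouredGraph n → Colour → Quad n → Bool
colourClassPerfectMatching Γ k (a , b , c , d) =
  exactlyOne (h a b) (h a c) (h a d) ∧
  exactlyOne (h b a) (h b c) (h b d) ∧
  exactlyOne (h c a) (h c b) (h c d) ∧
  exactlyOne (h d a) (h d b) (h d c)
  where h = hasColour Γ k

pairwiseAdjacent : ∀ {n} → ColouredGraph n → Quad n → Bool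
pairwiseAdjacent Γ (a , b , c , d) =
  adj a b ∧ adj a c ∧ adj a d ∧ adj b c ∧ adj b d ∧ adj c d
  where adj = adjacent Γ

properK4 : ∀ {n} → ColouredGraph n → Quad n → Bool
properK4 Γ q =
  pairwiseAdjacent Γ q ∧
  colourClassPerfectMatching Γ red q ∧
  colourClassPerfectMatching Γ green q ∧
  colourClassPerfectMatching Γ blue q

numProperK4 : ∀ {n} → ColouredGraph n → ℕ
numProperK4 {n} Γ = length (filter (λ q → Data.Bool.T? (properK4 Γ q)) (quads n))
  where import Data.Bool

-- Fix three distinct colours k₁, k₂, k₃. A properly coloured K₄ has two k₃-edges; orienting one
-- of them as (x, y), the other two vertices v, w complete a "diamond": the 4-cycle x v y w is
-- coloured k₁ k₂ k₁ k₂ and its diagonal xy has colour k₃. So every K₄ yields four diamonds, and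
-- writing p(x, y) for the number of k₁k₂-paths from x to y,
--   4K ≤ Σ_{xy ∈ k₃} p(x, y) p(y, x) ≤ Σ_{xy ∈ k₃} p(x, y)²
-- by 2ab ≤ a² + b² and the symmetry of the k₃-edges. The right-hand side counts "kites"
-- (x, v, w, y): k₁-edges xv, xw, k₂-edges vy, wy and the k₃-edge xy. Of the four orientations of
-- a k₁-edge {x, v} and a k₂-edge {w, y} at most one is a kite, since any two of them would give
-- some pair two colours; hence there are at most e(k₁) e(k₂) kites.
module Submission where

open import Data.Bool using (Bool; true; false; T; _∨_; not; if_then_else_)
open import Data.Bool.ListAction using (all)
open import Data.Fin using (Fin; zero; suc; toℕ)
open import Data.Fin.Patterns using (0F; 1F; 2F; 3F)
open import Data.Fin.Properties using (toℕ-injective)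
open import Data.List using (List; []; _∷_; _++_; map; filter; concatMap; length; tabulate; allFin)
open import Data.List.Membership.Propositional using (_∈_)
open import Data.List.Properties using (map-++; map-∘; map-tabulate)
open import Data.List.Relation.Unary.All using (lookup)
open import Data.List.Relation.Unary.All.Properties using (all⁺)
open import Data.List.Relation.Unary.Any using (here; there)
open import Data.Maybe using (Maybe; just; nothing; is-just)
open import Data.Nat using (ℕ; zero; suc; _+_; _*_; _≤_; _<_; _≤ᵇ_; _<ᵇ_; z≤n; s≤s)
open import Data.Nat.ListAction using () renaming (sum to sumˡ)
open import Data.Nat.ListAction.Properties using (sum-++)
open import Data.Nat.Properties
open import Data.Nat.Tactic.RingSolver using (solve-∀)
open import Data.Product using (_×_; _,_)
open import Data.Vec using (Vec; []; _∷_)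
open import Function using (_∘_)
open import Level using (0ℓ)
open import Relation.Binary.Definitions using (tri<; tri≈; tri>)
open import Relation.Binary.PropositionalEquality
open import Relation.Nullary using (does; yes; no)
open import Relation.Nullary.Decidable using (T?)
open import Relation.Unary using (Pred; Decidable)
open import Algebra.Properties.CommutativeSemigroup *-commutativeSemigroup using (x∙yz≈y∙xz)
open import Algebra.Properties.Semiring.Sum +-*-semiring
  using (sum; sum-cong-≗; ∑-distrib-+; ∑-comm; *-distribˡ-sum; *-distribʳ-sum)

open import Defs hiding (sym)

⟦_⟧ : Bool → ℕ
⟦ true ⟧ = 1
⟦ false ⟧ = 0

sum-mono-≤ : ∀ {n} {f g : Fin n → ℕ} → (∀ i → f i ≤ g i) → sum f ≤ sum g
sum-mono-≤ {zero} _ = z≤n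
sum-mono-≤ {suc n} f≤g = +-mono-≤ (f≤g zero) (sum-mono-≤ (f≤g ∘ suc))

2ab≤a²+b² : ∀ a b → 2 * (a * b) ≤ a * a + b * b
2ab≤a²+b² zero    b       = z≤n
2ab≤a²+b² (suc a) zero    = ≤-trans (≤-reflexive (cong (2 *_) (*-zeroʳ (suc a)))) z≤n
2ab≤a²+b² (suc a) (suc b) = begin
  2 * (suc a * suc b)                  ≡⟨ expand a b ⟩
  2 * (a * b) + 2 * (a + b + 1)        ≤⟨ +-monoˡ-≤ (2 * (a + b + 1)) (2ab≤a²+b² a b) ⟩
  a * a + b * b + 2 * (a + b + 1)      ≡⟨ collect a b ⟩
  suc a * suc a + suc b * suc b        ∎
  where
  open ≤-Reasoning
  expand : ∀ a b → 2 * (suc a * suc b) ≡ 2 * (a * b) + 2 * (a + b + 1)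
  expand = solve-∀
  collect : ∀ a b → a * a + b * b + 2 * (a + b + 1) ≡ suc a * suc a + suc b * suc b
  collect = solve-∀

module _ {n : ℕ} where

  ∑₂ : (Fin n → Fin n → ℕ) → ℕ
  ∑₂ f = sum λ x → sum (f x)

  ∑₃ : (Fin n → Fin n → Fin n → ℕ) → ℕ
  ∑₃ f = sum λ x → ∑₂ (f x)

  ∑₄ : (Fin n → Fin n → Fin n → Fin n → ℕ) → ℕ
  ∑₄ f = sum λ x → ∑₃ (f x)

  ∑₂-cong : ∀ {f g} → (∀ x y → f x y ≡ g x y) → ∑₂ f ≡ ∑₂ g
  ∑₂-cong f≡g = sum-cong-≗ λ x → sum-cong-≗ (f≡g x)

  ∑₃-cong : ∀ {f g} → (∀ x y z → f x y z ≡ g x y z) → ∑₃ f ≡ ∑₃ g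
  ∑₃-cong f≡g = sum-cong-≗ λ x → ∑₂-cong (f≡g x)

  ∑₄-cong : ∀ {f g} → (∀ x y z w → f x y z w ≡ g x y z w) → ∑₄ f ≡ ∑₄ g
  ∑₄-cong f≡g = sum-cong-≗ λ x → ∑₃-cong (f≡g x)

  ∑₂-mono-≤ : ∀ {f g} → (∀ x y → f x y ≤ g x y) → ∑₂ f ≤ ∑₂ g
  ∑₂-mono-≤ f≤g = sum-mono-≤ λ x → sum-mono-≤ (f≤g x)

  ∑₃-mono-≤ : ∀ {f g} → (∀ x y z → f x y z ≤ g x y z) → ∑₃ f ≤ ∑₃ g
  ∑₃-mono-≤ f≤g = sum-mono-≤ λ x → ∑₂-mono-≤ (f≤g x)

  ∑₄-mono-≤ : ∀ {f g} → (∀ x y z w → f x y z w ≤ g x y z w) → ∑₄ f ≤ ∑₄ g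
  ∑₄-mono-≤ f≤g = sum-mono-≤ λ x → ∑₃-mono-≤ (f≤g x)

  ∑₂-distrib-+ : ∀ f g → ∑₂ (λ x y → f x y + g x y) ≡ ∑₂ f + ∑₂ g
  ∑₂-distrib-+ f g =
    trans (sum-cong-≗ λ x → ∑-distrib-+ (f x) (g x)) (∑-distrib-+ (λ x → sum (f x)) (λ x → sum (g x)))

  ∑₃-distrib-+ : ∀ f g → ∑₃ (λ x y z → f x y z + g x y z) ≡ ∑₃ f + ∑₃ g
  ∑₃-distrib-+ f g =
    trans (sum-cong-≗ λ x → ∑₂-distrib-+ (f x) (g x)) (∑-distrib-+ (λ x → ∑₂ (f x)) (λ x → ∑₂ (g x)))

  ∑₄-distrib-+ : ∀ f g → ∑₄ (λ x y z w → f x y z w + g x y z w) ≡ ∑₄ f + ∑₄ g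
  ∑₄-distrib-+ f g =
    trans (sum-cong-≗ λ x → ∑₃-distrib-+ (f x) (g x)) (∑-distrib-+ (λ x → ∑₃ (f x)) (λ x → ∑₃ (g x)))

  *-distribˡ-∑₂ : ∀ c f → c * ∑₂ f ≡ ∑₂ (λ x y → c * f x y)
  *-distribˡ-∑₂ c f = trans (*-distribˡ-sum c λ x → sum (f x)) (sum-cong-≗ λ x → *-distribˡ-sum c (f x))

  *-distribˡ-∑₄ : ∀ c f → c * ∑₄ f ≡ ∑₄ (λ x y z w → c * f x y z w)
  *-distribˡ-∑₄ c f = trans (*-distribˡ-∑₂ c λ x y → ∑₂ (f x y)) (∑₂-cong λ x y → *-distribˡ-∑₂ c (f x y))

  ∑₂-product : ∀ f g → ∑₂ f * ∑₂ g ≡ ∑₄ (λ x y z w → f x y * g z w)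
  ∑₂-product f g = trans (*-distribʳ-∑₂ (∑₂ g) f) (∑₂-cong λ x y → *-distribˡ-∑₂ (f x y) g)
    where
    *-distribʳ-∑₂ : ∀ c f → ∑₂ f * c ≡ ∑₂ (λ x y → f x y * c)
    *-distribʳ-∑₂ c f = trans (*-distribʳ-sum c λ x → sum (f x)) (sum-cong-≗ λ x → *-distribʳ-sum c (f x))

  ∑₃-swap₂₃ : ∀ (h : Fin n → Fin n → Fin n → ℕ) → ∑₃ (λ a b c → h a c b) ≡ ∑₃ h
  ∑₃-swap₂₃ h = sum-cong-≗ λ a → ∑-comm (λ b c → h a c b)

  ∑₃-rotate : ∀ (h : Fin n → Fin n → Fin n → ℕ) → ∑₃ (λ a b c → h b c a) ≡ ∑₃ h
  ∑₃-rotate h = trans (∑-comm (λ a b → sum λ c → h b c a)) (sum-cong-≗ λ b → ∑-comm (λ a c → h b c a))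

  ∑₄-swap₃₄ : ∀ (h : Fin n → Fin n → Fin n → Fin n → ℕ) → ∑₄ (λ a b c d → h a b d c) ≡ ∑₄ h
  ∑₄-swap₃₄ h = sum-cong-≗ λ a → ∑₃-swap₂₃ (h a)

  ∑₄-rotate₂₃₄ : ∀ (h : Fin n → Fin n → Fin n → Fin n → ℕ) → ∑₄ (λ a b c d → h a c d b) ≡ ∑₄ h
  ∑₄-rotate₂₃₄ h = sum-cong-≗ λ a → ∑₃-rotate (h a)

  ∑₄-rotate : ∀ (h : Fin n → Fin n → Fin n → Fin n → ℕ) → ∑₄ (λ a b c d → h b c d a) ≡ ∑₄ h
  ∑₄-rotate h = trans (∑-comm (λ a b → ∑₂ λ c d → h b c d a)) (sum-cong-≗ λ b → ∑₃-rotate (h b))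

  ∑₃-distrib-+₃ : ∀ (f g h : Fin n → Fin n → Fin n → ℕ) →
    ∑₃ (λ a b c → f a b c + g a b c + h a b c) ≡ ∑₃ f + ∑₃ g + ∑₃ h
  ∑₃-distrib-+₃ f g h =
    trans (∑₃-distrib-+ (λ a b c → f a b c + g a b c) h) (cong (_+ ∑₃ h) (∑₃-distrib-+ f g))

  ∑₄-distrib-+₄ : ∀ (f g h k : Fin n → Fin n → Fin n → Fin n → ℕ) →
    ∑₄ (λ a b c d → f a b c d + g a b c d + h a b c d + k a b c d) ≡ ∑₄ f + ∑₄ g + ∑₄ h + ∑₄ k
  ∑₄-distrib-+₄ f g h k =
    trans (∑₄-distrib-+ (λ a b c d → f a b c d + g a b c d + h a b c d) k)
          (cong (_+ ∑₄ k) (trans (∑₄-distrib-+ (λ a b c d → f a b c d + g a b c d) h)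
                                 (cong (_+ ∑₄ h) (∑₄-distrib-+ f g))))

  ∑₂-scaled-product : ∀ (c : ℕ) (f g : Fin n → ℕ) → c * sum f * sum g ≡ ∑₂ λ v w → c * f v * g w
  ∑₂-scaled-product c f g = begin
    c * sum f * sum g            ≡⟨ cong (_* sum g) (*-distribˡ-sum c f) ⟩
    sum (λ v → c * f v) * sum g  ≡⟨ *-distribʳ-sum (sum g) (λ v → c * f v) ⟩
    sum (λ v → c * f v * sum g)  ≡⟨ sum-cong-≗ (λ v → *-distribˡ-sum (c * f v) g) ⟩
    ∑₂ (λ v w → c * f v * g w)   ∎
    where open ≡-Reasoning

  ∑₄-swap₁₂ : ∀ (h : Fin n → Fin n → Fin n → Fin n → ℕ) → ∑₄ (λ a b c d → h b a c d) ≡ ∑₄ h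
  ∑₄-swap₁₂ h = ∑-comm (λ a b → ∑₂ (h b a))

  ∑₄-orbit : ∀ (h : Fin n → Fin n → Fin n → Fin n → ℕ) →
    ∑₄ (λ p q s t → h p q s t + h q p s t + h p q t s + h q p t s) ≡ 4 * ∑₄ h
  ∑₄-orbit h = begin
    ∑₄ (λ p q s t → h p q s t + h q p s t + h p q t s + h q p t s)
      ≡⟨ ∑₄-distrib-+₄ h (λ p q s t → h q p s t) (λ p q s t → h p q t s) (λ p q s t → h q p t s) ⟩
    ∑₄ h + ∑₄ (λ p q s t → h q p s t) + ∑₄ (λ p q s t → h p q t s) + ∑₄ (λ p q s t → h q p t s)
      ≡⟨ cong₂ _+_ (cong₂ _+_ (cong (∑₄ h +_) (∑₄-swap₁₂ h)) (∑₄-swap₃₄ h))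
                   (trans (∑₄-swap₃₄ (λ p q s t → h q p s t)) (∑₄-swap₁₂ h)) ⟩
    ∑₄ h + ∑₄ h + ∑₄ h + ∑₄ h
      ≡⟨ four-times (∑₄ h) ⟩
    4 * ∑₄ h ∎
    where
    open ≡-Reasoning
    four-times : ∀ x → x + x + x + x ≡ 4 * x
    four-times = solve-∀

  ∑₂-cross≤square : ∀ (c r : Fin n → Fin n → ℕ) → (∀ x y → c x y ≡ c y x) →
    ∑₂ (λ x y → c x y * r x y * r y x) ≤ ∑₂ (λ x y → c x y * r x y * r x y)
  ∑₂-cross≤square c r c-sym = *-cancelˡ-≤ 2 (begin
    2 * ∑₂ (λ x y → c x y * r x y * r y x)
      ≡⟨ *-distribˡ-∑₂ 2 (λ x y → c x y * r x y * r y x) ⟩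
    ∑₂ (λ x y → 2 * (c x y * r x y * r y x))
      ≡⟨ ∑₂-cong (λ x y → reassoc (c x y) (r x y) (r y x)) ⟩
    ∑₂ (λ x y → c x y * (2 * (r x y * r y x)))
      ≤⟨ ∑₂-mono-≤ (λ x y → *-monoʳ-≤ (c x y) (2ab≤a²+b² (r x y) (r y x))) ⟩
    ∑₂ (λ x y → c x y * (r x y * r x y + r y x * r y x))
      ≡⟨ ∑₂-cong (λ x y → distrib (c x y) (r x y) (r y x)) ⟩
    ∑₂ (λ x y → c x y * r x y * r x y + c x y * r y x * r y x)
      ≡⟨ ∑₂-distrib-+ (λ x y → c x y * r x y * r x y) (λ x y → c x y * r y x * r y x) ⟩
    S + ∑₂ (λ x y → c x y * r y x * r y x)
      ≡⟨ cong (S +_) (trans (∑-comm (λ x y → c x y * r y x * r y x))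
                            (∑₂-cong λ y x → cong (λ z → z * r y x * r y x) (c-sym x y))) ⟩
    S + S
      ≡⟨ cong (S +_) (+-identityʳ S) ⟨
    2 * S ∎)
    where
    open ≤-Reasoning
    S = ∑₂ (λ x y → c x y * r x y * r x y)
    reassoc : ∀ c a b → 2 * (c * a * b) ≡ c * (2 * (a * b))
    reassoc = solve-∀
    distrib : ∀ c a b → c * (a * a + b * b) ≡ c * a * a + c * b * b
    distrib = solve-∀

<ᵇ-true : ∀ {m n} → m < n → (m <ᵇ n) ≡ true
<ᵇ-true {zero}  {suc n} _         = refl
<ᵇ-true {suc m} {suc n} (s≤s m<n) = <ᵇ-true m<n

<ᵇ-false : ∀ {m n} → n ≤ m → (m <ᵇ n) ≡ false
<ᵇ-false {m}     {zero}  _         = refl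
<ᵇ-false {suc m} {suc n} (s≤s n≤m) = <ᵇ-false n≤m

<ᵇ-irrefl : ∀ m → (m <ᵇ m) ≡ false
<ᵇ-irrefl m = <ᵇ-false {m} ≤-refl

<ᵇ-asym : ∀ m n → ⟦ m <ᵇ n ⟧ + ⟦ n <ᵇ m ⟧ ≤ 1
<ᵇ-asym m n with <-cmp m n
... | tri< m<n _ _    rewrite <ᵇ-true m<n | <ᵇ-false (<⇒≤ m<n) = ≤-refl
... | tri≈ _ refl _   rewrite <ᵇ-irrefl m = z≤n
... | tri> _ _ n<m    rewrite <ᵇ-false (<⇒≤ n<m) | <ᵇ-true n<m = ≤-refl

<ᵇ-no-between : ∀ {x y} z → y ≤ x → ⟦ x <ᵇ z ⟧ * ⟦ z <ᵇ y ⟧ ≡ 0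
<ᵇ-no-between {x} {y} z y≤x with x <? z
... | yes x<z rewrite <ᵇ-false (≤-trans y≤x (<⇒≤ x<z)) = *-zeroʳ ⟦ x <ᵇ z ⟧
... | no x≮z  rewrite <ᵇ-false (≮⇒≥ x≮z) = refl

<ᵇ-insert₂ : ∀ x y z →
  ⟦ z <ᵇ x ⟧ * ⟦ x <ᵇ y ⟧ + ⟦ x <ᵇ z ⟧ * ⟦ z <ᵇ y ⟧ + ⟦ x <ᵇ y ⟧ * ⟦ y <ᵇ z ⟧ ≤ ⟦ x <ᵇ y ⟧
<ᵇ-insert₂ x y z with x <? y
... | no x≮y
  rewrite <ᵇ-no-between z (≮⇒≥ x≮y) | <ᵇ-false (≮⇒≥ x≮y) | *-zeroʳ ⟦ z <ᵇ x ⟧ = z≤n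
... | yes x<y rewrite <ᵇ-true x<y with <-cmp z x
...   | tri< z<x _ _  rewrite <ᵇ-true z<x | <ᵇ-false (<⇒≤ z<x) | <ᵇ-false (<⇒≤ (<-trans z<x x<y)) = ≤-refl
...   | tri≈ _ refl _ rewrite <ᵇ-irrefl z | <ᵇ-false (<⇒≤ x<y) = z≤n
...   | tri> _ _ x<z  rewrite <ᵇ-false (<⇒≤ x<z) | <ᵇ-true x<z
                      | +-identityʳ ⟦ z <ᵇ y ⟧ | +-identityʳ ⟦ y <ᵇ z ⟧ = <ᵇ-asym z y

<ᵇ-insert₃ : ∀ a b c w →
  ⟦ w <ᵇ a ⟧ * ⟦ a <ᵇ b ⟧ * ⟦ b <ᵇ c ⟧ + ⟦ a <ᵇ w ⟧ * ⟦ w <ᵇ b ⟧ * ⟦ b <ᵇ c ⟧ +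
  ⟦ a <ᵇ b ⟧ * ⟦ b <ᵇ w ⟧ * ⟦ w <ᵇ c ⟧ + ⟦ a <ᵇ b ⟧ * ⟦ b <ᵇ c ⟧ * ⟦ c <ᵇ w ⟧ ≤ ⟦ a <ᵇ b ⟧ * ⟦ b <ᵇ c ⟧
<ᵇ-insert₃ a b c w with a <? b | b <? c
... | no a≮b | _
  rewrite <ᵇ-no-between w (≮⇒≥ a≮b) | <ᵇ-false (≮⇒≥ a≮b) | *-zeroʳ ⟦ w <ᵇ a ⟧ = z≤n
... | yes a<b | no b≮c
  rewrite <ᵇ-true a<b | <ᵇ-false (≮⇒≥ b≮c) | +-identityʳ ⟦ b <ᵇ w ⟧ | <ᵇ-no-between w (≮⇒≥ b≮c)
        | *-zeroʳ (⟦ w <ᵇ a ⟧ * 1) | *-zeroʳ (⟦ a <ᵇ w ⟧ * ⟦ w <ᵇ b ⟧) = z≤n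
... | yes a<b | yes b<c rewrite <ᵇ-true a<b | <ᵇ-true b<c with <-cmp w b
...   | tri< w<b _ _
  rewrite <ᵇ-true w<b | <ᵇ-false (<⇒≤ w<b) | <ᵇ-false (<⇒≤ (<-trans w<b b<c)) =
  ≤-trans (≤-reflexive (simplify ⟦ w <ᵇ a ⟧ ⟦ a <ᵇ w ⟧)) (<ᵇ-asym w a)
  where
  simplify : ∀ p q → p * 1 * 1 + q * 1 * 1 + 0 + (0 + 0) ≡ p + q
  simplify = solve-∀
...   | tri≈ _ refl _
  rewrite <ᵇ-irrefl w | <ᵇ-false (<⇒≤ a<b) | <ᵇ-false (<⇒≤ b<c) | *-zeroʳ ⟦ a <ᵇ w ⟧ = z≤n
...   | tri> _ _ b<w
  rewrite <ᵇ-false (<⇒≤ b<w) | <ᵇ-true b<w | <ᵇ-false (<⇒≤ (<-trans a<b b<w)) =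
  ≤-trans (≤-reflexive (simplify ⟦ a <ᵇ w ⟧ ⟦ w <ᵇ c ⟧ ⟦ c <ᵇ w ⟧)) (<ᵇ-asym w c)
  where
  simplify : ∀ q r s → 0 * 1 * 1 + q * 0 * 1 + (r + 0) + (s + 0) ≡ r + s
  simplify = solve-∀

infix 8 _≺_
_≺_ : ∀ {n} → Fin n → Fin n → ℕ
i ≺ j = ⟦ i <ⱽ j ⟧

module _ {n : ℕ} where

  ∑₂-symmetric : ∀ (e : Fin n → Fin n → ℕ) → (∀ x y → e x y ≡ e y x) → (∀ x → e x x ≡ 0) →
    ∑₂ e ≡ 2 * ∑₂ (λ x y → x ≺ y * e x y)
  ∑₂-symmetric e e-sym e-diag = begin
    ∑₂ e
      ≡⟨ ∑₂-cong split ⟩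
    ∑₂ (λ x y → x ≺ y * e x y + y ≺ x * e x y)
      ≡⟨ ∑₂-distrib-+ (λ x y → x ≺ y * e x y) (λ x y → y ≺ x * e x y) ⟩
    E + ∑₂ (λ x y → y ≺ x * e x y)
      ≡⟨ cong (E +_) (trans (∑-comm (λ x y → y ≺ x * e x y)) (∑₂-cong λ y x → cong (y ≺ x *_) (e-sym x y))) ⟩
    E + E
      ≡⟨ cong (E +_) (+-identityʳ E) ⟨
    2 * E ∎
    where
    open ≡-Reasoning
    E = ∑₂ (λ x y → x ≺ y * e x y)
    split : ∀ x y → e x y ≡ x ≺ y * e x y + y ≺ x * e x y
    split x y with <-cmp (toℕ x) (toℕ y)
    ... | tri< x<y _ _ rewrite <ᵇ-true x<y | <ᵇ-false (<⇒≤ x<y) = sym (trans (+-identityʳ _) (+-identityʳ _))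
    ... | tri> _ _ y<x rewrite <ᵇ-false (<⇒≤ y<x) | <ᵇ-true y<x = sym (+-identityʳ _)
    ... | tri≈ _ x≡y _ rewrite toℕ-injective x≡y | <ᵇ-irrefl (toℕ y) = e-diag y

permSum₂ : {A : Set} → (A → A → ℕ) → A → A → ℕ
permSum₂ f x y = f x y + f y x

permSum₃ : {A : Set} → (A → A → A → ℕ) → A → A → A → ℕ
permSum₃ f x y z =
  permSum₂ (λ a b → f a b x) y z + permSum₂ (λ a b → f a b y) x z + permSum₂ (λ a b → f a b z) x y

permSum₄ : {A : Set} → (A → A → A → A → ℕ) → A → A → A → A → ℕ
permSum₄ f x y z w =
  permSum₃ (λ a b c → f a b c x) y z w + permSum₃ (λ a b c → f a b c y) x z w +
  permSum₃ (λ a b c → f a b c z) x y w + permSum₃ (λ a b c → f a b c w) x y z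

module _ {n : ℕ} where

  ∑-permSum₂ : ∀ (f : Fin n → Fin n → Fin n → ℕ) x y →
    sum (λ w → permSum₂ (λ a b → f a b w) x y) ≡ permSum₂ (λ a b → sum (f a b)) x y
  ∑-permSum₂ f x y = ∑-distrib-+ (f x y) (f y x)

  ∑-permSum₃ : ∀ (f : Fin n → Fin n → Fin n → Fin n → ℕ) x y z →
    sum (λ w → permSum₃ (λ a b c → f a b c w) x y z) ≡ permSum₃ (λ a b c → sum (f a b c)) x y z
  ∑-permSum₃ f x y z = begin
    sum (λ w → P w y z x + P w x z y + P w x y z)
      ≡⟨ ∑-distrib-+ (λ w → P w y z x + P w x z y) (λ w → P w x y z) ⟩
    sum (λ w → P w y z x + P w x z y) + sum (λ w → P w x y z)
      ≡⟨ cong (_+ sum (λ w → P w x y z)) (∑-distrib-+ (λ w → P w y z x) (λ w → P w x z y)) ⟩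
    sum (λ w → P w y z x) + sum (λ w → P w x z y) + sum (λ w → P w x y z)
      ≡⟨ cong₂ _+_ (cong₂ _+_ (∑-permSum₂ (λ a b w → f a b x w) y z) (∑-permSum₂ (λ a b w → f a b y w) x z))
                   (∑-permSum₂ (λ a b w → f a b z w) x y) ⟩
    permSum₃ (λ a b c → sum (f a b c)) x y z ∎
    where
    open ≡-Reasoning
    P : Fin n → Fin n → Fin n → Fin n → ℕ
    P w a b c = permSum₂ (λ p q → f p q c w) a b

  ∑-sorted₂ : ∀ (f : Fin n → Fin n → ℕ) → ∑₂ (λ x y → x ≺ y * permSum₂ f x y) ≤ ∑₂ f
  ∑-sorted₂ f = begin
    ∑₂ (λ x y → x ≺ y * (f x y + f y x))
      ≡⟨ ∑₂-cong (λ x y → *-distribˡ-+ (x ≺ y) (f x y) (f y x)) ⟩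
    ∑₂ (λ x y → x ≺ y * f x y + x ≺ y * f y x)
      ≡⟨ ∑₂-distrib-+ (λ x y → x ≺ y * f x y) (λ x y → x ≺ y * f y x) ⟩
    ∑₂ (λ x y → x ≺ y * f x y) + ∑₂ (λ x y → x ≺ y * f y x)
      ≡⟨ cong (∑₂ (λ x y → x ≺ y * f x y) +_) (∑-comm (λ x y → x ≺ y * f y x)) ⟩
    ∑₂ (λ x y → x ≺ y * f x y) + ∑₂ (λ x y → y ≺ x * f x y)
      ≡⟨ ∑₂-distrib-+ (λ x y → x ≺ y * f x y) (λ x y → y ≺ x * f x y) ⟨
    ∑₂ (λ x y → x ≺ y * f x y + y ≺ x * f x y)
      ≡⟨ ∑₂-cong (λ x y → *-distribʳ-+ (f x y) (x ≺ y) (y ≺ x)) ⟨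
    ∑₂ (λ x y → (x ≺ y + y ≺ x) * f x y)
      ≤⟨ ∑₂-mono-≤ (λ x y → *-monoˡ-≤ (f x y) (<ᵇ-asym (toℕ x) (toℕ y))) ⟩
    ∑₂ (λ x y → 1 * f x y)
      ≡⟨ ∑₂-cong (λ x y → *-identityˡ (f x y)) ⟩
    ∑₂ f ∎
    where open ≤-Reasoning

  ∑-insert₃ : ∀ (F : Fin n → Fin n → Fin n → ℕ) →
    ∑₃ (λ a b c → a ≺ b * b ≺ c * (F b c a + F a c b + F a b c)) ≤ ∑₂ (λ x y → x ≺ y * sum (F x y))
  ∑-insert₃ F = begin
    ∑₃ (λ a b c → a ≺ b * b ≺ c * (F b c a + F a c b + F a b c))
      ≡⟨ ∑₃-cong (λ a b c → *-distribˡ-+₃ (a ≺ b * b ≺ c) (F b c a) (F a c b) (F a b c)) ⟩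
    ∑₃ (λ a b c → below b c a + between a c b + above a b c)
      ≡⟨ ∑₃-distrib-+₃ (λ a b c → below b c a) (λ a b c → between a c b) above ⟩
    ∑₃ (λ a b c → below b c a) + ∑₃ (λ a b c → between a c b) + ∑₃ above
      ≡⟨ cong (_+ ∑₃ above) (cong₂ _+_ (∑₃-rotate below) (∑₃-swap₂₃ between)) ⟩
    ∑₃ below + ∑₃ between + ∑₃ above
      ≡⟨ ∑₃-distrib-+₃ below between above ⟨
    ∑₃ (λ x y z → below x y z + between x y z + above x y z)
      ≡⟨ ∑₃-cong (λ x y z → *-distribʳ-+₃ (F x y z) (z ≺ x * x ≺ y) (x ≺ z * z ≺ y) (x ≺ y * y ≺ z)) ⟩
    ∑₃ (λ x y z → (z ≺ x * x ≺ y + x ≺ z * z ≺ y + x ≺ y * y ≺ z) * F x y z)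
      ≤⟨ ∑₃-mono-≤ (λ x y z → *-monoˡ-≤ (F x y z) (<ᵇ-insert₂ (toℕ x) (toℕ y) (toℕ z))) ⟩
    ∑₃ (λ x y z → x ≺ y * F x y z)
      ≡⟨ ∑₂-cong (λ x y → *-distribˡ-sum (x ≺ y) (F x y)) ⟨
    ∑₂ (λ x y → x ≺ y * sum (F x y)) ∎
    where
    open ≤-Reasoning
    below between above : Fin n → Fin n → Fin n → ℕ
    below   x y z = z ≺ x * x ≺ y * F x y z
    between x y z = x ≺ z * z ≺ y * F x y z
    above   x y z = x ≺ y * y ≺ z * F x y z
    *-distribˡ-+₃ : ∀ p x y z → p * (x + y + z) ≡ p * x + p * y + p * z
    *-distribˡ-+₃ = solve-∀
    *-distribʳ-+₃ : ∀ x p q r → p * x + q * x + r * x ≡ (p + q + r) * x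
    *-distribʳ-+₃ = solve-∀

  ∑-insert₄ : ∀ (G : Fin n → Fin n → Fin n → Fin n → ℕ) →
    ∑₄ (λ a b c d → a ≺ b * b ≺ c * c ≺ d * (G b c d a + G a c d b + G a b d c + G a b c d))
      ≤ ∑₃ (λ x y z → x ≺ y * y ≺ z * sum (G x y z))
  ∑-insert₄ G = begin
    ∑₄ (λ a b c d → a ≺ b * b ≺ c * c ≺ d * (G b c d a + G a c d b + G a b d c + G a b c d))
      ≡⟨ ∑₄-cong (λ a b c d → *-distribˡ-+₄ (a ≺ b * b ≺ c * c ≺ d) (G b c d a) (G a c d b) (G a b d c) (G a b c d)) ⟩
    ∑₄ (λ a b c d → pos₀ b c d a + pos₁ a c d b + pos₂ a b d c + pos₃ a b c d)
      ≡⟨ ∑₄-distrib-+₄ (λ a b c d → pos₀ b c d a) (λ a b c d → pos₁ a c d b) (λ a b c d → pos₂ a b d c) pos₃ ⟩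
    ∑₄ (λ a b c d → pos₀ b c d a) + ∑₄ (λ a b c d → pos₁ a c d b) + ∑₄ (λ a b c d → pos₂ a b d c) + ∑₄ pos₃
      ≡⟨ cong (_+ ∑₄ pos₃) (cong₂ _+_ (cong₂ _+_ (∑₄-rotate pos₀) (∑₄-rotate₂₃₄ pos₁)) (∑₄-swap₃₄ pos₂)) ⟩
    ∑₄ pos₀ + ∑₄ pos₁ + ∑₄ pos₂ + ∑₄ pos₃
      ≡⟨ ∑₄-distrib-+₄ pos₀ pos₁ pos₂ pos₃ ⟨
    ∑₄ (λ x y z w → pos₀ x y z w + pos₁ x y z w + pos₂ x y z w + pos₃ x y z w)
      ≡⟨ ∑₄-cong (λ x y z w → *-distribʳ-+₄ (G x y z w) (w ≺ x * x ≺ y * y ≺ z) (x ≺ w * w ≺ y * y ≺ z)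
                                                          (x ≺ y * y ≺ w * w ≺ z) (x ≺ y * y ≺ z * z ≺ w)) ⟩
    ∑₄ (λ x y z w → (w ≺ x * x ≺ y * y ≺ z + x ≺ w * w ≺ y * y ≺ z + x ≺ y * y ≺ w * w ≺ z + x ≺ y * y ≺ z * z ≺ w)
                     * G x y z w)
      ≤⟨ ∑₄-mono-≤ (λ x y z w → *-monoˡ-≤ (G x y z w) (<ᵇ-insert₃ (toℕ x) (toℕ y) (toℕ z) (toℕ w))) ⟩
    ∑₄ (λ x y z w → x ≺ y * y ≺ z * G x y z w)
      ≡⟨ ∑₃-cong (λ x y z → *-distribˡ-sum (x ≺ y * y ≺ z) (G x y z)) ⟨
    ∑₃ (λ x y z → x ≺ y * y ≺ z * sum (G x y z)) ∎
    where
    open ≤-Reasoning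
    pos₀ pos₁ pos₂ pos₃ : Fin n → Fin n → Fin n → Fin n → ℕ
    pos₀ x y z w = w ≺ x * x ≺ y * y ≺ z * G x y z w
    pos₁ x y z w = x ≺ w * w ≺ y * y ≺ z * G x y z w
    pos₂ x y z w = x ≺ y * y ≺ w * w ≺ z * G x y z w
    pos₃ x y z w = x ≺ y * y ≺ z * z ≺ w * G x y z w
    *-distribˡ-+₄ : ∀ p x y z w → p * (x + y + z + w) ≡ p * x + p * y + p * z + p * w
    *-distribˡ-+₄ = solve-∀
    *-distribʳ-+₄ : ∀ x p q r s → p * x + q * x + r * x + s * x ≡ (p + q + r + s) * x
    *-distribʳ-+₄ = solve-∀

  ∑-sorted₃ : ∀ (f : Fin n → Fin n → Fin n → ℕ) → ∑₃ (λ x y z → x ≺ y * y ≺ z * permSum₃ f x y z) ≤ ∑₃ f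
  ∑-sorted₃ f = begin
    ∑₃ (λ x y z → x ≺ y * y ≺ z * permSum₃ f x y z)
      ≤⟨ ∑-insert₃ (λ x y z → permSum₂ (λ a b → f a b z) x y) ⟩
    ∑₂ (λ x y → x ≺ y * sum (λ z → permSum₂ (λ a b → f a b z) x y))
      ≡⟨ ∑₂-cong (λ x y → cong (x ≺ y *_) (∑-permSum₂ f x y)) ⟩
    ∑₂ (λ x y → x ≺ y * permSum₂ (λ a b → sum (f a b)) x y)
      ≤⟨ ∑-sorted₂ (λ a b → sum (f a b)) ⟩
    ∑₃ f ∎
    where open ≤-Reasoning

  ∑-sorted₄ : ∀ (f : Fin n → Fin n → Fin n → Fin n → ℕ) →
    ∑₄ (λ x y z w → x ≺ y * y ≺ z * z ≺ w * permSum₄ f x y z w) ≤ ∑₄ f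
  ∑-sorted₄ f = begin
    ∑₄ (λ x y z w → x ≺ y * y ≺ z * z ≺ w * permSum₄ f x y z w)
      ≤⟨ ∑-insert₄ (λ x y z w → permSum₃ (λ a b c → f a b c w) x y z) ⟩
    ∑₃ (λ x y z → x ≺ y * y ≺ z * sum (λ w → permSum₃ (λ a b c → f a b c w) x y z))
      ≡⟨ ∑₃-cong (λ x y z → cong (x ≺ y * y ≺ z *_) (∑-permSum₃ f x y z)) ⟩
    ∑₃ (λ x y z → x ≺ y * y ≺ z * permSum₃ (λ a b c → sum (f a b c)) x y z)
      ≤⟨ ∑-sorted₃ (λ a b c → sum (f a b c)) ⟩
    ∑₄ f ∎
    where open ≤-Reasoning

isColour : Colour → Maybe Colour → Bool
isColour k nothing   = false
isColour k (just k′) = k′ ==ᶜ k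

edge : {A : Set} → (A → A → Maybe Colour) → Colour → A → A → ℕ
edge c k x y = ⟦ isColour k (c x y) ⟧

module _ {A : Set} (c : A → A → Maybe Colour) (k₁ k₂ k₃ : Colour) where

  diamond : A → A → A → A → ℕ
  diamond x y v w = edge c k₃ x y * (edge c k₁ x v * edge c k₂ v y) * (edge c k₁ y w * edge c k₂ w x)

  kite : A → A → A → A → ℕ
  kite x v w y = edge c k₃ x y * (edge c k₁ x v * edge c k₂ v y) * (edge c k₁ x w * edge c k₂ w y)

paths : ∀ {n} → (Fin n → Fin n → Maybe Colour) → Colour → Colour → Fin n → Fin n → ℕ
paths c k₁ k₂ x y = sum λ v → edge c k₁ x v * edge c k₂ v y

module _ {n} (c : Fin n → Fin n → Maybe Colour) (k₁ k₂ k₃ : Colour) where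

  diamonds-as-paths : ∑₄ (diamond c k₁ k₂ k₃) ≡ ∑₂ λ x y → edge c k₃ x y * paths c k₁ k₂ x y * paths c k₁ k₂ y x
  diamonds-as-paths = sym (∑₂-cong λ x y →
    ∑₂-scaled-product (edge c k₃ x y) (λ v → edge c k₁ x v * edge c k₂ v y) (λ w → edge c k₁ y w * edge c k₂ w x))

  kites-as-paths : ∑₄ (kite c k₁ k₂ k₃) ≡ ∑₂ λ x y → edge c k₃ x y * paths c k₁ k₂ x y * paths c k₁ k₂ x y
  kites-as-paths = trans (sym (∑₄-rotate₂₃₄ (kite c k₁ k₂ k₃))) (sym (∑₂-cong λ x y →
    ∑₂-scaled-product (edge c k₃ x y) (λ v → edge c k₁ x v * edge c k₂ v y) (λ w → edge c k₁ x w * edge c k₂ w y)))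

∑ˡ : {A : Set} → (A → ℕ) → List A → ℕ
∑ˡ w xs = sumˡ (map w xs)

module _ {A : Set} {P : Pred A 0ℓ} (P? : Decidable P) where

  length-filter : ∀ (xs : List A) → length (filter P? xs) ≡ ∑ˡ (λ x → ⟦ does (P? x) ⟧) xs
  length-filter [] = refl
  length-filter (x ∷ xs) with does (P? x)
  ... | true  = cong suc (length-filter xs)
  ... | false = length-filter xs

  ∑ˡ-filter : ∀ (w : A → ℕ) (xs : List A) → ∑ˡ w (filter P? xs) ≡ ∑ˡ (λ x → ⟦ does (P? x) ⟧ * w x) xs
  ∑ˡ-filter w [] = refl
  ∑ˡ-filter w (x ∷ xs) with does (P? x)
  ... | true  = cong₂ _+_ (sym (+-identityʳ (w x))) (∑ˡ-filter w xs)
  ... | false = ∑ˡ-filter w xs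

∑ˡ-map : {A B : Set} (w : B → ℕ) (g : A → B) (xs : List A) → ∑ˡ w (map g xs) ≡ ∑ˡ (w ∘ g) xs
∑ˡ-map w g xs = cong sumˡ (sym (map-∘ xs))

∑ˡ-concatMap : {A B : Set} (w : B → ℕ) (f : A → List B) (xs : List A) → ∑ˡ w (concatMap f xs) ≡ ∑ˡ (∑ˡ w ∘ f) xs
∑ˡ-concatMap w f [] = refl
∑ˡ-concatMap w f (x ∷ xs) = begin
  sumˡ (map w (f x ++ concatMap f xs))             ≡⟨ cong sumˡ (map-++ w (f x) (concatMap f xs)) ⟩
  sumˡ (map w (f x) ++ map w (concatMap f xs))     ≡⟨ sum-++ (map w (f x)) _ ⟩
  ∑ˡ w (f x) + ∑ˡ w (concatMap f xs)               ≡⟨ cong (∑ˡ w (f x) +_) (∑ˡ-concatMap w f xs) ⟩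
  ∑ˡ w (f x) + ∑ˡ (∑ˡ w ∘ f) xs                    ∎
  where open ≡-Reasoning

∑ˡ-allFin : ∀ {n} (w : Fin n → ℕ) → ∑ˡ w (allFin n) ≡ sum w
∑ˡ-allFin w = trans (cong sumˡ (map-tabulate (λ i → i) w)) (sumˡ-tabulate w)
  where
  sumˡ-tabulate : ∀ {n} (w : Fin n → ℕ) → sumˡ (tabulate w) ≡ sum w
  sumˡ-tabulate {zero} w = refl
  sumˡ-tabulate {suc n} w = cong (w zero +_) (sumˡ-tabulate (w ∘ suc))

∑ˡ-pairs : ∀ {n} (w : Fin n × Fin n → ℕ) → ∑ˡ w (pairs n) ≡ ∑₂ λ i j → i ≺ j * w (i , j)
∑ˡ-pairs {n} w = begin
  ∑ˡ w (pairs n)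
    ≡⟨ ∑ˡ-concatMap w (λ i → map (i ,_) (later i)) (allFin n) ⟩
  ∑ˡ (λ i → ∑ˡ w (map (i ,_) (later i))) (allFin n)
    ≡⟨ ∑ˡ-allFin (λ i → ∑ˡ w (map (i ,_) (later i))) ⟩
  sum (λ i → ∑ˡ w (map (i ,_) (later i)))
    ≡⟨ sum-cong-≗ (λ i → trans (∑ˡ-map w (i ,_) (later i))
                         (trans (∑ˡ-filter (T? ∘ (i <ⱽ_)) (λ j → w (i , j)) (allFin n))
                                (∑ˡ-allFin λ j → i ≺ j * w (i , j)))) ⟩
  ∑₂ (λ i j → i ≺ j * w (i , j)) ∎
  where
  open ≡-Reasoning
  later : Fin n → List (Fin n)
  later i = filter (T? ∘ (i <ⱽ_)) (allFin n)

hasColour-isColour : ∀ {n} (Γ : ColouredGraph n) k i j → hasColour Γ k i j ≡ isColour k (col Γ i j)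
hasColour-isColour Γ k i j with col Γ i j
... | nothing = refl
... | just _  = refl

adjacent-is-just : ∀ {n} (Γ : ColouredGraph n) i j → adjacent Γ i j ≡ is-just (col Γ i j)
adjacent-is-just Γ i j with col Γ i j
... | nothing = refl
... | just _  = refl

numEdges-∑ : ∀ {n} (Γ : ColouredGraph n) k → numEdges Γ k ≡ ∑₂ λ i j → i ≺ j * edge (col Γ) k i j
numEdges-∑ {n} Γ k = begin
  numEdges Γ k                                      ≡⟨ length-filter _ (pairs n) ⟩
  ∑ˡ (λ { (i , j) → ⟦ hasColour Γ k i j ⟧ }) (pairs n) ≡⟨ ∑ˡ-pairs {n} _ ⟩
  ∑₂ (λ i j → i ≺ j * ⟦ hasColour Γ k i j ⟧)          ≡⟨ ∑₂-cong (λ i j → cong (λ b → i ≺ j * ⟦ b ⟧) (hasColour-isColour Γ k i j)) ⟩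
  ∑₂ (λ i j → i ≺ j * edge (col Γ) k i j)             ∎
  where open ≡-Reasoning

∑ˡ-singleton-if : {A : Set} (w : A → ℕ) (b : Bool) (x : A) → ∑ˡ w (if b then x ∷ [] else []) ≡ ⟦ b ⟧ * w x
∑ˡ-singleton-if w true  x = cong (w x +_) (sym (+-identityʳ 0))
∑ˡ-singleton-if w false x = refl

numProperK4-∑ : ∀ {n} (Γ : ColouredGraph n) →
  numProperK4 Γ ≡ ∑₄ λ a b c d → a ≺ b * b ≺ c * c ≺ d * ⟦ properK4 Γ (a , b , c , d) ⟧
numProperK4-∑ {n} Γ = begin
  numProperK4 Γ
    ≡⟨ trans (length-filter _ (quads n)) (trans (∑ˡ-concatMap P _ (pairs n)) (∑ˡ-pairs {n} _)) ⟩
  ∑₂ (λ a b → a ≺ b * ∑ˡ P (concatMap (λ { (c , d) → if b <ⱽ c then (a , b , c , d) ∷ [] else [] }) (pairs n)))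
    ≡⟨ ∑₂-cong (λ a b → cong (a ≺ b *_) (trans (∑ˡ-concatMap P _ (pairs n)) (trans (∑ˡ-pairs {n} _)
         (∑₂-cong λ c d → cong (c ≺ d *_) (∑ˡ-singleton-if P (b <ⱽ c) (a , b , c , d)))))) ⟩
  ∑₂ (λ a b → a ≺ b * ∑₂ λ c d → c ≺ d * (b ≺ c * P (a , b , c , d)))
    ≡⟨ ∑₂-cong (λ a b → *-distribˡ-∑₂ (a ≺ b) λ c d → c ≺ d * (b ≺ c * P (a , b , c , d))) ⟩
  ∑₄ (λ a b c d → a ≺ b * (c ≺ d * (b ≺ c * P (a , b , c , d))))
    ≡⟨ ∑₄-cong (λ a b c d → reorder (a ≺ b) (b ≺ c) (c ≺ d) (P (a , b , c , d))) ⟩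
  ∑₄ (λ a b c d → a ≺ b * b ≺ c * c ≺ d * P (a , b , c , d))
    ∎
  where
  open ≡-Reasoning
  P : Quad n → ℕ
  P q = ⟦ properK4 Γ q ⟧
  reorder : ∀ p q r x → p * (r * (q * x)) ≡ p * q * r * x
  reorder = solve-∀

pairColour : (ab ac ad bc bd cd : Maybe Colour) → Fin 4 → Fin 4 → Maybe Colour
pairColour ab ac ad bc bd cd 0F 1F = ab
pairColour ab ac ad bc bd cd 0F 2F = ac
pairColour ab ac ad bc bd cd 0F 3F = ad
pairColour ab ac ad bc bd cd 1F 2F = bc
pairColour ab ac ad bc bd cd 1F 3F = bd
pairColour ab ac ad bc bd cd 2F 3F = cd
pairColour ab ac ad bc bd cd 1F 0F = ab
pairColour ab ac ad bc bd cd 2F 0F = ac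
pairColour ab ac ad bc bd cd 3F 0F = ad
pairColour ab ac ad bc bd cd 2F 1F = bc
pairColour ab ac ad bc bd cd 3F 1F = bd
pairColour ab ac ad bc bd cd 3F 2F = cd
pairColour ab ac ad bc bd cd _  _  = nothing

quadGraph : (ab ac ad bc bd cd : Maybe Colour) → ColouredGraph 4
quadGraph ab ac ad bc bd cd = record
  { col      = pairColour ab ac ad bc bd cd
  ; loopless = λ { 0F → refl ; 1F → refl ; 2F → refl ; 3F → refl }
  ; sym      = λ { 0F 0F → refl ; 0F 1F → refl ; 0F 2F → refl ; 0F 3F → refl
                 ; 1F 0F → refl ; 1F 1F → refl ; 1F 2F → refl ; 1F 3F → refl
                 ; 2F 0F → refl ; 2F 1F → refl ; 2F 2F → refl ; 2F 3F → refl
                 ; 3F 0F → refl ; 3F 1F → refl ; 3F 2F → refl ; 3F 3F → refl }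
  }

data Distinct : Colour → Colour → Colour → Set where
  rgb : Distinct red green blue
  rbg : Distinct red blue green
  grb : Distinct green red blue
  gbr : Distinct green blue red
  brg : Distinct blue red green
  bgr : Distinct blue green red

distinctTriples : List (Colour × Colour × Colour)
distinctTriples = (red , green , blue) ∷ (red , blue , green) ∷ (green , red , blue) ∷
                  (green , blue , red) ∷ (blue , red , green) ∷ (blue , green , red) ∷ []

∈-distinctTriples : ∀ {k₁ k₂ k₃} → Distinct k₁ k₂ k₃ → (k₁ , k₂ , k₃) ∈ distinctTriples
∈-distinctTriples rgb = here refl
∈-distinctTriples rbg = there (here refl)
∈-distinctTriples grb = there (there (here refl))
∈-distinctTriples gbr = there (there (there (here refl)))
∈-distinctTriples brg = there (there (there (there (here refl))))
∈-distinctTriples bgr = there (there (there (there (there (here refl)))))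

everyDistinct : (Colour → Colour → Colour → Bool) → Bool
everyDistinct p = all (λ { (k₁ , k₂ , k₃) → p k₁ k₂ k₃ }) distinctTriples

everyDistinct-sound : ∀ p {k₁ k₂ k₃} → T (everyDistinct p) → Distinct k₁ k₂ k₃ → T (p k₁ k₂ k₃)
everyDistinct-sound p every-p distinct =
  lookup (all⁺ (λ { (k₁ , k₂ , k₃) → p k₁ k₂ k₃ }) distinctTriples every-p) (∈-distinctTriples distinct)

colourings : List (Maybe Colour)
colourings = nothing ∷ just red ∷ just green ∷ just blue ∷ []

∈-colourings : ∀ m → m ∈ colourings
∈-colourings nothing      = here refl
∈-colourings (just red)   = there (here refl)
∈-colourings (just green) = there (there (here refl))
∈-colourings (just blue)  = there (there (there (here refl)))

everyColouring : ∀ k → (Vec (Maybe Colour) k → Bool) → Bool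
everyColouring zero    p = p []
everyColouring (suc k) p = all (λ m → everyColouring k λ ms → p (m ∷ ms)) colourings

everyColouring-sound : ∀ k p → T (everyColouring k p) → ∀ ms → T (p ms)
everyColouring-sound zero    p every-p [] = every-p
everyColouring-sound (suc k) p every-p (m ∷ ms) =
  everyColouring-sound k (λ ms → p (m ∷ ms))
    (lookup (all⁺ (λ m → everyColouring k λ ms → p (m ∷ ms)) colourings every-p) (∈-colourings m)) ms

quadGraphᵛ : Vec (Maybe Colour) 6 → ColouredGraph 4
quadGraphᵛ (ab ∷ ac ∷ ad ∷ bc ∷ bd ∷ cd ∷ []) = quadGraph ab ac ad bc bd cd

diamondsCover : ColouredGraph 4 → Colour → Colour → Colour → Bool
diamondsCover Δ k₁ k₂ k₃ = 4 ≤ᵇ permSum₄ (diamond (col Δ) k₁ k₂ k₃) 0F 1F 2F 3F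

kitesBounded : ColouredGraph 4 → Colour → Colour → Colour → Bool
kitesBounded Δ k₁ k₂ k₃ =
  kite c k₁ k₂ k₃ 0F 1F 2F 3F + kite c k₁ k₂ k₃ 1F 0F 2F 3F +
  kite c k₁ k₂ k₃ 0F 1F 3F 2F + kite c k₁ k₂ k₃ 1F 0F 3F 2F
    ≤ᵇ edge c k₁ 0F 1F * edge c k₂ 2F 3F
  where c = col Δ

properK4⇒diamondsCover : ColouredGraph 4 → Bool
properK4⇒diamondsCover Δ = not (properK4 Δ (0F , 1F , 2F , 3F)) ∨ everyDistinct (diamondsCover Δ)

T-not-∨ : ∀ b {c} → T (not b ∨ c) → T b → T c
T-not-∨ true c _ = c

*-⟦⟧-≤ : ∀ b {m n} → (T b → m ≤ n) → m * ⟦ b ⟧ ≤ n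
*-⟦⟧-≤ true      m≤n = ≤-trans (≤-reflexive (*-identityʳ _)) (m≤n _)
*-⟦⟧-≤ false {m} _   = ≤-trans (≤-reflexive (*-zeroʳ m)) z≤n

-- In both lemmas below the omitted argument of everyColouring-sound is the check over all 4⁶
-- colourings of the six pairs; Agda discharges it by evaluation.
module _ (ab ac ad bc bd cd : Maybe Colour) {k₁ k₂ k₃ : Colour} (distinct : Distinct k₁ k₂ k₃) where

  private
    Δ : ColouredGraph 4
    Δ = quadGraph ab ac ad bc bd cd

  quad-properK4≤diamonds :
    4 * ⟦ properK4 Δ (0F , 1F , 2F , 3F) ⟧ ≤ permSum₄ (diamond (col Δ) k₁ k₂ k₃) 0F 1F 2F 3F
  quad-properK4≤diamonds = *-⟦⟧-≤ (properK4 Δ (0F , 1F , 2F , 3F)) λ proper →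
    ≤ᵇ⇒≤ _ _ (everyDistinct-sound (diamondsCover Δ) (T-not-∨ (properK4 Δ (0F , 1F , 2F , 3F))
      (everyColouring-sound 6 (λ ms → properK4⇒diamondsCover (quadGraphᵛ ms)) _ (ab ∷ ac ∷ ad ∷ bc ∷ bd ∷ cd ∷ [])) proper) distinct)

  quad-kites≤edges :
    kite (col Δ) k₁ k₂ k₃ 0F 1F 2F 3F + kite (col Δ) k₁ k₂ k₃ 1F 0F 2F 3F +
    kite (col Δ) k₁ k₂ k₃ 0F 1F 3F 2F + kite (col Δ) k₁ k₂ k₃ 1F 0F 3F 2F
      ≤ edge (col Δ) k₁ 0F 1F * edge (col Δ) k₂ 2F 3F
  quad-kites≤edges = ≤ᵇ⇒≤ _ _ (everyDistinct-sound (kitesBounded Δ)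
    (everyColouring-sound 6 (λ ms → everyDistinct (kitesBounded (quadGraphᵛ ms))) _ (ab ∷ ac ∷ ad ∷ bc ∷ bd ∷ cd ∷ [])) distinct)

hasColour-cong : ∀ {n m} (Γ : ColouredGraph n) (Δ : ColouredGraph m) {x y i j} k →
  col Γ x y ≡ col Δ i j → hasColour Γ k x y ≡ hasColour Δ k i j
hasColour-cong Γ Δ {x} {y} {i} {j} k col≡ =
  trans (hasColour-isColour Γ k x y) (trans (cong (isColour k) col≡) (sym (hasColour-isColour Δ k i j)))

adjacent-cong : ∀ {n m} (Γ : ColouredGraph n) (Δ : ColouredGraph m) {x y i j} →
  col Γ x y ≡ col Δ i j → adjacent Γ x y ≡ adjacent Δ i j
adjacent-cong Γ Δ {x} {y} {i} {j} col≡ =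
  trans (adjacent-is-just Γ x y) (trans (cong is-just col≡) (sym (adjacent-is-just Δ i j)))

properK4-cong : ∀ {n m} (Γ : ColouredGraph n) (Δ : ColouredGraph m) (φ : Fin m → Fin n) →
  (∀ k i j → hasColour Γ k (φ i) (φ j) ≡ hasColour Δ k i j) →
  (∀ i j → adjacent Γ (φ i) (φ j) ≡ adjacent Δ i j) →
  ∀ a b c d → properK4 Γ (φ a , φ b , φ c , φ d) ≡ properK4 Δ (a , b , c , d)
properK4-cong Γ Δ φ h e a b c d
  rewrite e a b | e a c | e a d | e b c | e b d | e c d
        | h red a b   | h red a c   | h red a d   | h red b a   | h red b c   | h red b d
        | h red c a   | h red c b   | h red c d   | h red d a   | h red d b   | h red d c
        | h green a b | h green a c | h green a d | h green b a | h green b c | h green b d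
        | h green c a | h green c b | h green c d | h green d a | h green d b | h green d c
        | h blue a b  | h blue a c  | h blue a d  | h blue b a  | h blue b c  | h blue b d
        | h blue c a  | h blue c b  | h blue c d  | h blue d a  | h blue d b  | h blue d c
  = refl

module FourVertices {n} (Γ : ColouredGraph n) (a b c d : Fin n) where

  private
    local : ColouredGraph 4
    local = quadGraph (col Γ a b) (col Γ a c) (col Γ a d) (col Γ b c) (col Γ b d) (col Γ c d)

    vertex : Fin 4 → Fin n
    vertex 0F = a
    vertex 1F = b
    vertex 2F = c
    vertex 3F = d

    col-local : ∀ i j → col Γ (vertex i) (vertex j) ≡ col local i j
    col-local 0F 0F = loopless Γ a
    col-local 0F 1F = refl
    col-local 0F 2F = refl
    col-local 0F 3F = refl
    col-local 1F 0F = ColouredGraph.sym Γ b a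
    col-local 1F 1F = loopless Γ b
    col-local 1F 2F = refl
    col-local 1F 3F = refl
    col-local 2F 0F = ColouredGraph.sym Γ c a
    col-local 2F 1F = ColouredGraph.sym Γ c b
    col-local 2F 2F = loopless Γ c
    col-local 2F 3F = refl
    col-local 3F 0F = ColouredGraph.sym Γ d a
    col-local 3F 1F = ColouredGraph.sym Γ d b
    col-local 3F 2F = ColouredGraph.sym Γ d c
    col-local 3F 3F = loopless Γ d

  module _ {k₁ k₂ k₃ : Colour} (distinct : Distinct k₁ k₂ k₃) where

    properK4≤diamonds : 4 * ⟦ properK4 Γ (a , b , c , d) ⟧ ≤ permSum₄ (diamond (col Γ) k₁ k₂ k₃) a b c d
    properK4≤diamonds
      rewrite properK4-cong Γ local vertex (λ k i j → hasColour-cong Γ local k (col-local i j))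
                                  (λ i j → adjacent-cong Γ local (col-local i j)) 0F 1F 2F 3F
            | ColouredGraph.sym Γ b a | ColouredGraph.sym Γ c a | ColouredGraph.sym Γ d a
            | ColouredGraph.sym Γ c b | ColouredGraph.sym Γ d b | ColouredGraph.sym Γ d c
      = quad-properK4≤diamonds (col Γ a b) (col Γ a c) (col Γ a d) (col Γ b c) (col Γ b d) (col Γ c d) distinct

    kites≤edges :
      kite (col Γ) k₁ k₂ k₃ a b c d + kite (col Γ) k₁ k₂ k₃ b a c d +
      kite (col Γ) k₁ k₂ k₃ a b d c + kite (col Γ) k₁ k₂ k₃ b a d c
        ≤ edge (col Γ) k₁ a b * edge (col Γ) k₂ c d
    kites≤edges
      rewrite ColouredGraph.sym Γ b a | ColouredGraph.sym Γ d c
      = quad-kites≤edges (col Γ a b) (col Γ a c) (col Γ a d) (col Γ b c) (col Γ b d) (col Γ c d) distinct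

module _ {n} (Γ : ColouredGraph n) where

  edge-sym : ∀ k x y → edge (col Γ) k x y ≡ edge (col Γ) k y x
  edge-sym k x y = cong (λ m → ⟦ isColour k m ⟧) (ColouredGraph.sym Γ x y)

  ∑₂-edge : ∀ k → ∑₂ (edge (col Γ) k) ≡ 2 * numEdges Γ k
  ∑₂-edge k = trans (∑₂-symmetric (edge (col Γ) k) (edge-sym k) (λ x → cong (λ m → ⟦ isColour k m ⟧) (loopless Γ x)))
                    (cong (2 *_) (sym (numEdges-∑ Γ k)))

  diamonds≤kites : ∀ k₁ k₂ k₃ → ∑₄ (diamond (col Γ) k₁ k₂ k₃) ≤ ∑₄ (kite (col Γ) k₁ k₂ k₃)
  diamonds≤kites k₁ k₂ k₃ = begin
    ∑₄ (diamond (col Γ) k₁ k₂ k₃)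
      ≡⟨ diamonds-as-paths (col Γ) k₁ k₂ k₃ ⟩
    ∑₂ (λ x y → edge (col Γ) k₃ x y * paths (col Γ) k₁ k₂ x y * paths (col Γ) k₁ k₂ y x)
      ≤⟨ ∑₂-cross≤square (edge (col Γ) k₃) (paths (col Γ) k₁ k₂) (edge-sym k₃) ⟩
    ∑₂ (λ x y → edge (col Γ) k₃ x y * paths (col Γ) k₁ k₂ x y * paths (col Γ) k₁ k₂ x y)
      ≡⟨ kites-as-paths (col Γ) k₁ k₂ k₃ ⟨
    ∑₄ (kite (col Γ) k₁ k₂ k₃) ∎
    where open ≤-Reasoning

  module _ {k₁ k₂ k₃ : Colour} (distinct : Distinct k₁ k₂ k₃) where

    properK4s≤diamonds : 4 * numProperK4 Γ ≤ ∑₄ (diamond (col Γ) k₁ k₂ k₃)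
    properK4s≤diamonds = begin
      4 * numProperK4 Γ
        ≡⟨ cong (4 *_) (numProperK4-∑ Γ) ⟩
      4 * ∑₄ (λ a b c d → ascending a b c d * ⟦ properK4 Γ (a , b , c , d) ⟧)
        ≡⟨ *-distribˡ-∑₄ 4 (λ a b c d → ascending a b c d * ⟦ properK4 Γ (a , b , c , d) ⟧) ⟩
      ∑₄ (λ a b c d → 4 * (ascending a b c d * ⟦ properK4 Γ (a , b , c , d) ⟧))
        ≡⟨ ∑₄-cong (λ a b c d → x∙yz≈y∙xz 4 (ascending a b c d) ⟦ properK4 Γ (a , b , c , d) ⟧) ⟩
      ∑₄ (λ a b c d → ascending a b c d * (4 * ⟦ properK4 Γ (a , b , c , d) ⟧))
        ≤⟨ ∑₄-mono-≤ (λ a b c d → *-monoʳ-≤ (ascending a b c d) (FourVertices.properK4≤diamonds Γ a b c d distinct)) ⟩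
      ∑₄ (λ a b c d → ascending a b c d * permSum₄ (diamond (col Γ) k₁ k₂ k₃) a b c d)
        ≤⟨ ∑-sorted₄ (diamond (col Γ) k₁ k₂ k₃) ⟩
      ∑₄ (diamond (col Γ) k₁ k₂ k₃) ∎
      where
      open ≤-Reasoning
      ascending : Fin n → Fin n → Fin n → Fin n → ℕ
      ascending a b c d = a ≺ b * b ≺ c * c ≺ d

    kites≤numEdges : ∑₄ (kite (col Γ) k₁ k₂ k₃) ≤ numEdges Γ k₁ * numEdges Γ k₂
    kites≤numEdges = *-cancelˡ-≤ 4 (begin
      4 * ∑₄ (kite (col Γ) k₁ k₂ k₃)
        ≡⟨ ∑₄-orbit (kite (col Γ) k₁ k₂ k₃) ⟨
      ∑₄ (λ p q s t → kite (col Γ) k₁ k₂ k₃ p q s t + kite (col Γ) k₁ k₂ k₃ q p s t +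
                      kite (col Γ) k₁ k₂ k₃ p q t s + kite (col Γ) k₁ k₂ k₃ q p t s)
        ≤⟨ ∑₄-mono-≤ (λ p q s t → FourVertices.kites≤edges Γ p q s t distinct) ⟩
      ∑₄ (λ p q s t → edge (col Γ) k₁ p q * edge (col Γ) k₂ s t)
        ≡⟨ ∑₂-product (edge (col Γ) k₁) (edge (col Γ) k₂) ⟨
      ∑₂ (edge (col Γ) k₁) * ∑₂ (edge (col Γ) k₂)
        ≡⟨ cong₂ _*_ (∑₂-edge k₁) (∑₂-edge k₂) ⟩
      2 * numEdges Γ k₁ * (2 * numEdges Γ k₂)
        ≡⟨ regroup (numEdges Γ k₁) (numEdges Γ k₂) ⟩
      4 * (numEdges Γ k₁ * numEdges Γ k₂) ∎)
      where
      open ≤-Reasoning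
      regroup : ∀ x y → 2 * x * (2 * y) ≡ 4 * (x * y)
      regroup = solve-∀

    properK4s≤numEdges : 4 * numProperK4 Γ ≤ numEdges Γ k₁ * numEdges Γ k₂
    properK4s≤numEdges = ≤-trans properK4s≤diamonds (≤-trans (diamonds≤kites k₁ k₂ k₃) kites≤numEdges)

claim3p2 : ∀ (n : ℕ) (Γ : ColouredGraph n) →
    (4 * numProperK4 Γ ≤ numEdges Γ red * numEdges Γ green) ×
    (4 * numProperK4 Γ ≤ numEdges Γ green * numEdges Γ blue) ×
    (4 * numProperK4 Γ ≤ numEdges Γ red * numEdges Γ blue)
claim3p2 n Γ = properK4s≤numEdges Γ rgb , properK4s≤numEdges Γ gbr , properK4s≤numEdges Γ rbg
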